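{- Let $n \ge 2$ and $u \in \mathbb{F}_2^n$. Let $D_2(u)$ be the set of vectors in $\mathbb{F}_2^{n-2}$ obtainable from $u$ by deleting two of its components, let $r(u)$ be the number of runs of $u$, let $u' \in \mathbb{F}_2^{n-1}$ be the derivative of $u$ and $u'' \in \mathbb{F}_2^{n-2}$ the derivative of $u'$. Then $$|D_2(u)| = \binom{r(u)+1}{2} - \delta, \qquad \text{where } \delta = 2\,\mathrm{wt}(u') - \mathrm{wt}(u'').$$
   Context: A run of $u$ is a maximal block of consecutive equal symbols. The derivative of $u=(u_1,\ldots,u_n)$ is $u' = (u_1+u_2, u_2+u_3, \ldots, u_{n-1}+u_n)$ with addition mod 2 (for a vector of length 1 the derivative is the empty vector). $\mathrm{wt}$ denotes Hamming weight (number of nonzero coordinates). -}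

module Defs where

open import Data.Bool using (Bool; true; false; _xor_; if_then_else_)
open import Data.Bool.Properties using () renaming (_≟_ to _≟B_)
open import Data.Nat using (ℕ; zero; suc; _+_)
open import Data.Fin using (Fin)
open import Data.Vec using (Vec; []; _∷_; removeAt)
open import Data.List using (List; length)
open import Data.List.Relation.Unary.Unique.Propositional using (Unique)
open import Data.List.Membership.Propositional using (_∈_)
open import Data.Product using (Σ; ∃; _×_; _,_)
open import Relation.Binary.PropositionalEquality using (_≡_)
open import Function.Bundles using (_⇔_)

-- F₂ is modelled by Bool, with addition mod 2 given by xor; F₂^n = Vec Bool n.

wt : ∀ {n} → Vec Bool n → ℕ
wt []           = 0
wt (true ∷ xs)  = suc (wt xs)
wt (false ∷ xs) = wt xs

deriv : ∀ {n} → Vec Bool (suc n) → Vec Bool n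
deriv (x ∷ [])     = []
deriv (x ∷ y ∷ xs) = (x xor y) ∷ deriv (y ∷ xs)

-- Number of runs (maximal blocks of equal consecutive symbols):
-- counted as the number of run starts (position 1, and each position
-- whose symbol differs from the preceding one).
runs : ∀ {n} → Vec Bool n → ℕ
runs []           = 0
runs (x ∷ [])     = 1
runs (x ∷ y ∷ xs) = (if x xor y then 1 else 0) + runs (y ∷ xs)

-- v is obtainable from u by deleting two (distinct) components of u:
-- first delete position i of u, then position j of the result.
Del2 : ∀ {m} → Vec Bool (suc (suc m)) → Vec Bool m → Set
Del2 {m} u v = Σ (Fin (suc (suc m))) λ i → Σ (Fin (suc m)) λ j → v ≡ removeAt (removeAt u i) j

HasCard-D2 : ∀ {m} → Vec Bool (suc (suc m)) → ℕ → Set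
HasCard-D2 {m} u k =
  Σ (List (Vec Bool m)) λ xs →
    Unique xs × (∀ v → (v ∈ xs) ⇔ Del2 u v) × length xs ≡ k

-- Deletions from x ∷ v split according to whether x survives: those keeping x are
-- x ∷ (deletions from v), the others begin with the symbol following the deleted ones and
-- are new only when that symbol differs from x.  With one deletion this yields one new word
-- per change of symbol, so |D₁(u)| = r(u); with two it yields y ∷ D₁(tail) when x ≠ y and
-- at most one word otherwise.  The resulting recurrence for |D₂(u)| is the one satisfied by
-- binom(r(u)+1, 2) − 2 wt(u') + wt(u''), Pascal's rule accounting for a new run at the front.
module Submission where

open import Defs
open import Data.Nat using (ℕ; suc) renaming (_+_ to _+ℕ_)
open import Data.Nat.Combinatorics using (_C_)
open import Data.Integer using (ℤ; +_; _-_; _*_)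
open import Data.Vec using (Vec)
open import Data.Bool using (Bool)
open import Data.Product using (Σ; _×_)
open import Relation.Binary.PropositionalEquality using (_≡_)

open import Data.Bool using (true; false; not; _xor_; if_then_else_)
open import Data.Nat using () renaming (_*_ to _*ℕ_)
open import Data.Nat.Combinatorics using (nCk+nC[k+1]≡[n+1]C[k+1]; nC1≡n)
open import Data.Nat.Tactic.RingSolver using (solve-∀)
open import Data.Nat.Properties using (+-comm; +-commutativeSemigroup)
open import Algebra.Properties.CommutativeSemigroup +-commutativeSemigroup using (xy∙z≈xz∙y; xy∙z≈x∙zy)
open import Data.Integer.Properties using (pos-+; pos-*)
open import Data.Integer.Tactic.RingSolver as ℤ-Solver using ()
open import Data.Fin using (Fin; zero; suc)
open import Data.Vec using ([]; _∷_; removeAt; head)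
open import Data.Vec.Properties using (∷-injectiveʳ)
open import Data.List using (List; []; _∷_; _++_; map; length)
open import Data.List.Properties using (length-++; length-map)
open import Data.List.Membership.Propositional using (_∈_)
open import Data.List.Membership.Propositional.Properties using (∈-map⁺; ∈-map⁻; ∈-++⁺ˡ; ∈-++⁺ʳ; ∈-++⁻)
open import Data.List.Relation.Unary.Any using (here)
open import Data.List.Relation.Unary.All using ([])
open import Data.List.Relation.Unary.AllPairs using ([]; _∷_)
open import Data.List.Relation.Unary.Unique.Propositional using (Unique)
open import Data.List.Relation.Unary.Unique.Propositional.Properties using (map⁺; ++⁺)
open import Data.List.Relation.Binary.Disjoint.Propositional using (Disjoint)
open import Data.Product using (_,_)
open import Data.Sum using (inj₁; inj₂)
open import Function.Bundles using (_⇔_; mk⇔)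
open import Relation.Binary.PropositionalEquality using (_≢_; refl; sym; trans; cong; cong₂; module ≡-Reasoning)

private
  variable
    n : ℕ

bit : Bool → ℕ
bit b = if b then 1 else 0

removeAt-suc : ∀ {A : Set} (x : A) (v : Vec A (suc n)) j → removeAt (x ∷ v) (suc j) ≡ x ∷ removeAt v j
removeAt-suc x (_ ∷ _) j = refl

wt-∷ : ∀ b (v : Vec Bool n) → wt (b ∷ v) ≡ bit b +ℕ wt v
wt-∷ true  v = refl
wt-∷ false v = refl

mutual
  deletions₁ : Vec Bool (suc n) → List (Vec Bool n)
  deletions₁ (x ∷ [])    = [] ∷ []
  deletions₁ (x ∷ y ∷ t) = map (x ∷_) (deletions₁ (y ∷ t)) ++ fresh₁ x y t

  -- the deletions of x ∷ y ∷ t that do not begin with x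
  fresh₁ : Bool → Bool → Vec Bool n → List (Vec Bool (suc n))
  fresh₁ x y t = if x xor y then (y ∷ t) ∷ [] else []

mutual
  deletions₂ : Vec Bool (suc (suc n)) → List (Vec Bool n)
  deletions₂ (x ∷ y ∷ [])    = [] ∷ []
  deletions₂ (x ∷ y ∷ z ∷ t) = map (x ∷_) (deletions₂ (y ∷ z ∷ t)) ++ fresh₂ x y z t

  -- the deletions of x ∷ y ∷ z ∷ t that do not begin with x
  fresh₂ : Bool → Bool → Bool → Vec Bool n → List (Vec Bool (suc n))
  fresh₂ x y z t = if x xor y then map (y ∷_) (deletions₁ (z ∷ t)) else fresh₁ y z t

∈-keep-head₁ : ∀ x y (t : Vec Bool n) {w} → w ∈ deletions₁ (y ∷ t) → x ∷ w ∈ deletions₁ (x ∷ y ∷ t)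
∈-keep-head₁ x y t w∈ = ∈-++⁺ˡ (∈-map⁺ (x ∷_) w∈)

∈-keep-head₂ : ∀ x y z (t : Vec Bool n) {w} →
  w ∈ deletions₂ (y ∷ z ∷ t) → x ∷ w ∈ deletions₂ (x ∷ y ∷ z ∷ t)
∈-keep-head₂ x y z t w∈ = ∈-++⁺ˡ (∈-map⁺ (x ∷_) w∈)

∈-fresh₂ : ∀ x y z (t : Vec Bool n) {w} → w ∈ fresh₂ x y z t → w ∈ deletions₂ (x ∷ y ∷ z ∷ t)
∈-fresh₂ x y z t = ∈-++⁺ʳ _

removeAt-∈-deletions₁ : ∀ (u : Vec Bool (suc n)) i → removeAt u i ∈ deletions₁ u
removeAt-∈-deletions₁ (x ∷ [])            zero    = here refl
removeAt-∈-deletions₁ (x ∷ y ∷ t)         (suc i) = ∈-keep-head₁ x y t (removeAt-∈-deletions₁ (y ∷ t) i)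
removeAt-∈-deletions₁ (true  ∷ true  ∷ t) zero    = ∈-keep-head₁ true true t (removeAt-∈-deletions₁ (true ∷ t) zero)
removeAt-∈-deletions₁ (false ∷ false ∷ t) zero    = ∈-keep-head₁ false false t (removeAt-∈-deletions₁ (false ∷ t) zero)
removeAt-∈-deletions₁ (true  ∷ false ∷ t) zero    = ∈-++⁺ʳ _ (here refl)
removeAt-∈-deletions₁ (false ∷ true  ∷ t) zero    = ∈-++⁺ʳ _ (here refl)

∈-fresh₁⇒≡ : ∀ x y (t : Vec Bool n) {w} → w ∈ fresh₁ x y t → w ≡ y ∷ t
∈-fresh₁⇒≡ true  false t (here w≡) = w≡
∈-fresh₁⇒≡ false true  t (here w≡) = w≡

∈-deletions₁⇒removeAt : ∀ (u : Vec Bool (suc n)) {w} → w ∈ deletions₁ u → Σ (Fin (suc n)) λ i → w ≡ removeAt u i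
∈-deletions₁⇒removeAt (x ∷ [])    {[]} _ = zero , refl
∈-deletions₁⇒removeAt (x ∷ y ∷ t) w∈ with ∈-++⁻ (map (x ∷_) (deletions₁ (y ∷ t))) w∈
... | inj₂ w∈fresh = zero , ∈-fresh₁⇒≡ x y t w∈fresh
... | inj₁ w∈kept with ∈-map⁻ (x ∷_) w∈kept
...   | w′ , w′∈ , refl with ∈-deletions₁⇒removeAt (y ∷ t) w′∈
...     | i , refl = suc i , refl

mutual
  removeAt²-∈-deletions₂ : ∀ (u : Vec Bool (suc (suc n))) i j → removeAt (removeAt u i) j ∈ deletions₂ u
  removeAt²-∈-deletions₂ (x ∷ y ∷ [])    i       j       with removeAt (removeAt (x ∷ y ∷ []) i) j
  ... | [] = here refl
  removeAt²-∈-deletions₂ (x ∷ y ∷ z ∷ t) zero    j       = removeAt-∈-deletions₂-∷ x y z t j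
  removeAt²-∈-deletions₂ (x ∷ y ∷ z ∷ t) (suc i) zero    = removeAt-∈-deletions₂-∷ x y z t i
  removeAt²-∈-deletions₂ (x ∷ y ∷ z ∷ t) (suc i) (suc j) rewrite removeAt-suc x (removeAt (y ∷ z ∷ t) i) j =
    ∈-keep-head₂ x y z t (removeAt²-∈-deletions₂ (y ∷ z ∷ t) i j)

  removeAt-∈-deletions₂-∷ : ∀ x y z (t : Vec Bool n) j → removeAt (y ∷ z ∷ t) j ∈ deletions₂ (x ∷ y ∷ z ∷ t)
  removeAt-∈-deletions₂-∷ true  true  z t (suc j) = ∈-keep-head₂ true true z t (removeAt²-∈-deletions₂ (true ∷ z ∷ t) zero j)
  removeAt-∈-deletions₂-∷ false false z t (suc j) = ∈-keep-head₂ false false z t (removeAt²-∈-deletions₂ (false ∷ z ∷ t) zero j)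
  removeAt-∈-deletions₂-∷ true  false z t (suc j) = ∈-fresh₂ true false z t (∈-map⁺ (false ∷_) (removeAt-∈-deletions₁ (z ∷ t) j))
  removeAt-∈-deletions₂-∷ false true  z t (suc j) = ∈-fresh₂ false true z t (∈-map⁺ (true ∷_) (removeAt-∈-deletions₁ (z ∷ t) j))
  removeAt-∈-deletions₂-∷ true  y true  t zero = ∈-keep-head₂ true y true t (removeAt²-∈-deletions₂ (y ∷ true ∷ t) zero zero)
  removeAt-∈-deletions₂-∷ false y false t zero = ∈-keep-head₂ false y false t (removeAt²-∈-deletions₂ (y ∷ false ∷ t) zero zero)
  removeAt-∈-deletions₂-∷ true  true  false t zero = ∈-fresh₂ true true false t (here refl)
  removeAt-∈-deletions₂-∷ false false true  t zero = ∈-fresh₂ false false true t (here refl)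
  removeAt-∈-deletions₂-∷ true  false false t zero = ∈-fresh₂ true false false t (∈-map⁺ (false ∷_) (removeAt-∈-deletions₁ (false ∷ t) zero))
  removeAt-∈-deletions₂-∷ false true  true  t zero = ∈-fresh₂ false true true t (∈-map⁺ (true ∷_) (removeAt-∈-deletions₁ (true ∷ t) zero))

∈-fresh₂⇒Del2 : ∀ x y z (t : Vec Bool n) {w} → w ∈ fresh₂ x y z t → Del2 (x ∷ y ∷ z ∷ t) w
∈-fresh₂⇒Del2 true  true  z t w∈ = zero , zero , ∈-fresh₁⇒≡ true z t w∈
∈-fresh₂⇒Del2 false false z t w∈ = zero , zero , ∈-fresh₁⇒≡ false z t w∈
∈-fresh₂⇒Del2 true  false z t w∈ with ∈-map⁻ (false ∷_) w∈
... | w′ , w′∈ , refl with ∈-deletions₁⇒removeAt (z ∷ t) w′∈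
...   | j , refl = zero , suc j , refl
∈-fresh₂⇒Del2 false true  z t w∈ with ∈-map⁻ (true ∷_) w∈
... | w′ , w′∈ , refl with ∈-deletions₁⇒removeAt (z ∷ t) w′∈
...   | j , refl = zero , suc j , refl

∈-deletions₂⇒Del2 : ∀ (u : Vec Bool (suc (suc n))) {w} → w ∈ deletions₂ u → Del2 u w
∈-deletions₂⇒Del2 (x ∷ y ∷ [])    {[]} _ = zero , zero , refl
∈-deletions₂⇒Del2 (x ∷ y ∷ z ∷ t) w∈ with ∈-++⁻ (map (x ∷_) (deletions₂ (y ∷ z ∷ t))) w∈
... | inj₂ w∈fresh = ∈-fresh₂⇒Del2 x y z t w∈fresh
... | inj₁ w∈kept with ∈-map⁻ (x ∷_) w∈kept
...   | w′ , w′∈ , refl with ∈-deletions₂⇒Del2 (y ∷ z ∷ t) w′∈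
...     | i , j , refl = suc i , suc j , sym (removeAt-suc x (removeAt (y ∷ z ∷ t) i) j)

∈-deletions₂⇔Del2 : ∀ (u : Vec Bool (suc (suc n))) w → (w ∈ deletions₂ u) ⇔ Del2 u w
∈-deletions₂⇔Del2 u w = mk⇔ (∈-deletions₂⇒Del2 u) λ { (i , j , refl) → removeAt²-∈-deletions₂ u i j }

unique-map-∷-++ : ∀ {A : Set} {m} (x : A) {xs : List (Vec A m)} {ys} → Unique xs → Unique ys →
  (∀ {w} → w ∈ ys → head w ≢ x) → Unique (map (x ∷_) xs ++ ys)
unique-map-∷-++ x {xs} {ys} xs! ys! heads = ++⁺ (map⁺ ∷-injectiveʳ xs!) ys! disjoint
  where
  disjoint : Disjoint (map (x ∷_) xs) ys
  disjoint (w∈xs , w∈ys) with ∈-map⁻ (x ∷_) w∈xs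
  ... | _ , _ , refl = heads w∈ys refl

fresh₁-head : ∀ x y (t : Vec Bool n) {w} → w ∈ fresh₁ x y t → head w ≢ x
fresh₁-head true  false t (here refl) ()
fresh₁-head false true  t (here refl) ()

fresh₂-head : ∀ x y z (t : Vec Bool n) {w} → w ∈ fresh₂ x y z t → head w ≢ x
fresh₂-head true  true  z t w∈ = fresh₁-head true z t w∈
fresh₂-head false false z t w∈ = fresh₁-head false z t w∈
fresh₂-head true  false z t w∈ with ∈-map⁻ (false ∷_) w∈
... | _ , _ , refl = λ ()
fresh₂-head false true  z t w∈ with ∈-map⁻ (true ∷_) w∈
... | _ , _ , refl = λ ()

fresh₁-unique : ∀ x y (t : Vec Bool n) → Unique (fresh₁ x y t)
fresh₁-unique x y t with x xor y
... | true  = [] ∷ []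
... | false = []

deletions₁-unique : ∀ (u : Vec Bool (suc n)) → Unique (deletions₁ u)
deletions₁-unique (x ∷ [])    = [] ∷ []
deletions₁-unique (x ∷ y ∷ t) =
  unique-map-∷-++ x (deletions₁-unique (y ∷ t)) (fresh₁-unique x y t) (fresh₁-head x y t)

fresh₂-unique : ∀ x y z (t : Vec Bool n) → Unique (fresh₂ x y z t)
fresh₂-unique x y z t with x xor y
... | true  = map⁺ ∷-injectiveʳ (deletions₁-unique (z ∷ t))
... | false = fresh₁-unique y z t

deletions₂-unique : ∀ (u : Vec Bool (suc (suc n))) → Unique (deletions₂ u)
deletions₂-unique (x ∷ y ∷ [])    = [] ∷ []
deletions₂-unique (x ∷ y ∷ z ∷ t) =
  unique-map-∷-++ x (deletions₂-unique (y ∷ z ∷ t)) (fresh₂-unique x y z t) (fresh₂-head x y z t)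

length-fresh₁ : ∀ x y (t : Vec Bool n) → length (fresh₁ x y t) ≡ bit (x xor y)
length-fresh₁ x y t with x xor y
... | true  = refl
... | false = refl

length-deletions₁ : ∀ (u : Vec Bool (suc n)) → length (deletions₁ u) ≡ runs u
length-deletions₁ (x ∷ [])    = refl
length-deletions₁ (x ∷ y ∷ t) = begin
  length (map (x ∷_) (deletions₁ (y ∷ t)) ++ fresh₁ x y t)     ≡⟨ length-++ (map (x ∷_) (deletions₁ (y ∷ t))) ⟩
  length (map (x ∷_) (deletions₁ (y ∷ t))) +ℕ length (fresh₁ x y t)
    ≡⟨ cong₂ _+ℕ_ (trans (length-map (x ∷_) (deletions₁ (y ∷ t))) (length-deletions₁ (y ∷ t))) (length-fresh₁ x y t) ⟩
  runs (y ∷ t) +ℕ bit (x xor y)                                  ≡⟨ +-comm (runs (y ∷ t)) (bit (x xor y)) ⟩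
  runs (x ∷ y ∷ t)                                               ∎
  where open ≡-Reasoning

length-fresh₂ : ∀ x y z (t : Vec Bool n) →
  length (fresh₂ x y z t) ≡ (if x xor y then runs (z ∷ t) else bit (y xor z))
length-fresh₂ x y z t with x xor y
... | true  = trans (length-map (y ∷_) (deletions₁ (z ∷ t))) (length-deletions₁ (z ∷ t))
... | false = length-fresh₁ y z t

length-deletions₂-∷ : ∀ x y z (t : Vec Bool n) → length (deletions₂ (x ∷ y ∷ z ∷ t)) ≡
  length (deletions₂ (y ∷ z ∷ t)) +ℕ (if x xor y then runs (z ∷ t) else bit (y xor z))
length-deletions₂-∷ x y z t =
  trans (length-++ (map (x ∷_) (deletions₂ (y ∷ z ∷ t))))
        (cong₂ _+ℕ_ (length-map (x ∷_) (deletions₂ (y ∷ z ∷ t))) (length-fresh₂ x y z t))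

pascal₂ : ∀ m → suc m C 2 ≡ m +ℕ m C 2
pascal₂ m = trans (sym (nCk+nC[k+1]≡[n+1]C[k+1] m 1)) (cong (_+ℕ m C 2) (nC1≡n m))

-- a = [x ≠ y] and b = [y ≠ z] for the first three symbols x y z; R counts the runs of z ∷ t.
count-step : ∀ a b {L W W₂ R} → L +ℕ 2 *ℕ W ≡ (bit b +ℕ R +ℕ 1) C 2 +ℕ W₂ →
  (L +ℕ (if a then R else bit b)) +ℕ 2 *ℕ (bit a +ℕ W) ≡ (bit a +ℕ (bit b +ℕ R) +ℕ 1) C 2 +ℕ (bit (a xor b) +ℕ W₂)
count-step false b {L} {W} {W₂} {R} h = begin
  L +ℕ bit b +ℕ 2 *ℕ W      ≡⟨ xy∙z≈xz∙y L (bit b) (2 *ℕ W) ⟩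
  L +ℕ 2 *ℕ W +ℕ bit b      ≡⟨ cong (_+ℕ bit b) h ⟩
  P +ℕ W₂ +ℕ bit b          ≡⟨ xy∙z≈x∙zy P W₂ (bit b) ⟩
  P +ℕ (bit b +ℕ W₂)        ∎
  where
  open ≡-Reasoning
  P : ℕ
  P = (bit b +ℕ R +ℕ 1) C 2
count-step true b {L} {W} {W₂} {R} h = begin
  L +ℕ R +ℕ 2 *ℕ (1 +ℕ W)                        ≡⟨ regroup L R W ⟩
  L +ℕ 2 *ℕ W +ℕ (R +ℕ 2)                        ≡⟨ cong (_+ℕ (R +ℕ 2)) h ⟩
  P +ℕ W₂ +ℕ (R +ℕ 2)                            ≡⟨ redistribute b P W₂ R ⟩
  bit b +ℕ R +ℕ 1 +ℕ P +ℕ (bit (not b) +ℕ W₂)    ≡⟨ cong (_+ℕ (bit (not b) +ℕ W₂)) (sym (pascal₂ (bit b +ℕ R +ℕ 1))) ⟩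
  suc (bit b +ℕ R +ℕ 1) C 2 +ℕ (bit (not b) +ℕ W₂) ∎
  where
  open ≡-Reasoning
  P : ℕ
  P = (bit b +ℕ R +ℕ 1) C 2
  regroup : ∀ L R W → L +ℕ R +ℕ 2 *ℕ (1 +ℕ W) ≡ L +ℕ 2 *ℕ W +ℕ (R +ℕ 2)
  regroup = solve-∀
  redistribute : ∀ b P W₂ R → P +ℕ W₂ +ℕ (R +ℕ 2) ≡ bit b +ℕ R +ℕ 1 +ℕ P +ℕ (bit (not b) +ℕ W₂)
  redistribute true  = solve-∀
  redistribute false = solve-∀

length-deletions₂ : ∀ (u : Vec Bool (suc (suc n))) →
  length (deletions₂ u) +ℕ 2 *ℕ wt (deriv u) ≡ (runs u +ℕ 1) C 2 +ℕ wt (deriv (deriv u))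
length-deletions₂ (true  ∷ true  ∷ []) = refl
length-deletions₂ (true  ∷ false ∷ []) = refl
length-deletions₂ (false ∷ true  ∷ []) = refl
length-deletions₂ (false ∷ false ∷ []) = refl
length-deletions₂ u@(x ∷ v@(y ∷ z ∷ t)) = begin
  length (deletions₂ u) +ℕ 2 *ℕ wt (deriv u)
    ≡⟨ cong₂ (λ l w → l +ℕ 2 *ℕ w) (length-deletions₂-∷ x y z t) (wt-∷ (x xor y) (deriv v)) ⟩
  length (deletions₂ v) +ℕ (if x xor y then runs (z ∷ t) else bit (y xor z)) +ℕ 2 *ℕ (bit (x xor y) +ℕ wt (deriv v))
    ≡⟨ count-step (x xor y) (y xor z) {L = length (deletions₂ v)} {R = runs (z ∷ t)} (length-deletions₂ v) ⟩
  (runs u +ℕ 1) C 2 +ℕ (bit ((x xor y) xor (y xor z)) +ℕ wt (deriv (deriv v)))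
    ≡⟨ cong ((runs u +ℕ 1) C 2 +ℕ_) (sym (wt-∷ ((x xor y) xor (y xor z)) (deriv (deriv v)))) ⟩
  (runs u +ℕ 1) C 2 +ℕ wt (deriv (deriv u))
    ∎
  where open ≡-Reasoning

m+n≡o+p⇒m≡o-[n-p] : ∀ {m n o p} → m +ℕ n ≡ o +ℕ p → + m ≡ + o - (+ n - + p)
m+n≡o+p⇒m≡o-[n-p] {m} {n} {o} {p} eq = begin
  + m                      ≡⟨ cancel (+ m) (+ n) ⟩
  + m + + n - + n          ≡⟨ cong (_- + n) (sym (pos-+ m n)) ⟩
  + (m +ℕ n) - + n         ≡⟨ cong (λ k → + k - + n) eq ⟩
  + (o +ℕ p) - + n         ≡⟨ cong (_- + n) (pos-+ o p) ⟩
  + o + + p - + n          ≡⟨ reassociate (+ o) (+ p) (+ n) ⟩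
  + o - (+ n - + p)        ∎
  where
  open ≡-Reasoning
  open Data.Integer using (_+_)
  cancel : ∀ a b → a ≡ a + b - b
  cancel = ℤ-Solver.solve-∀
  reassociate : ∀ a b c → a + b - c ≡ a - (c - b)
  reassociate = ℤ-Solver.solve-∀

theorem6 : (m : ℕ) (u : Vec Bool (suc (suc m))) →
    Σ ℕ λ k → HasCard-D2 u k ×
      (+ k ≡ + ((runs u +ℕ 1) C 2) - ((+ 2) * (+ wt (deriv u)) - + wt (deriv (deriv u))))
theorem6 m u =
  length (deletions₂ u) ,
  (deletions₂ u , deletions₂-unique u , ∈-deletions₂⇔Del2 u , refl) ,
  trans (m+n≡o+p⇒m≡o-[n-p] {m = length (deletions₂ u)} {o = runs+1C2} {p = wt (deriv (deriv u))} (length-deletions₂ u))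
        (cong (λ w → + runs+1C2 - (w - + wt (deriv (deriv u)))) (pos-* 2 (wt (deriv u))))
  where
  runs+1C2 : ℕ
  runs+1C2 = (runs u +ℕ 1) C 2
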